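{- Every chordal graph has a terminal set.
   Context: A graph is chordal if every induced cycle has length three. A set $S \subseteq V(G)$ is in general position if no shortest path of $G$ contains three vertices of $S$. A terminal set of $G$ is a general position set $S$ that is maximal under inclusion and such that for every $u \in V(G)\setminus S$ there is a shortest path of $G$ with $u$ as an endpoint containing at least two vertices of $S$. -}

module Defs where

open import Data.Nat using (ℕ; zero; suc; _≤_; _∸_)
open import Data.Fin using (Fin; toℕ)
open import Data.Fin.Subset using (Subset; _∈_; _∉_; _⊆_)
open import Data.Product using (Σ; ∃; _×_; _,_)
open import Data.Sum using (_⊎_)
open import Data.Empty using (⊥)
open import Relation.Nullary using (¬_; Dec)
open import Relation.Binary.PropositionalEquality using (_≡_; _≢_)
open import Function.Definitions using (Injective)
open import Level using (0ℓ)

record Graph (n : ℕ) : Set₁ where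
  field
    Adj      : Fin n → Fin n → Set
    adj?     : ∀ u v → Dec (Adj u v)
    sym      : ∀ {u v} → Adj u v → Adj v u
    irrefl   : ∀ {u} → ¬ Adj u u

module _ {n : ℕ} (G : Graph n) where
  open Graph G

  data Walk : Fin n → Fin n → Set where
    []ʷ  : ∀ {u} → Walk u u
    _∷ʷ_ : ∀ {u w v} → Adj u w → Walk w v → Walk u v

  len : ∀ {u v} → Walk u v → ℕ
  len []ʷ      = zero
  len (_ ∷ʷ p) = suc (len p)

  data On (x : Fin n) : ∀ {u v} → Walk u v → Set where
    here  : ∀ {v} {p : Walk x v} → On x p
    there : ∀ {u w v} {e : Adj u w} {p : Walk w v} → On x p → On x (e ∷ʷ p)

  -- A shortest path (geodesic) from u to v: no walk from u to v is shorter.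
  -- (A shortest walk is necessarily a path.)
  IsShortest : ∀ {u v} → Walk u v → Set
  IsShortest {u} {v} p = ∀ (q : Walk u v) → len p ≤ len q

  GeneralPosition : Subset n → Set
  GeneralPosition S =
    ∀ {u v} (p : Walk u v) → IsShortest p →
    ∀ x y z → x ∈ S → y ∈ S → z ∈ S →
    x ≢ y → y ≢ z → x ≢ z →
    On x p → On y p → On z p → ⊥

  MaximalGeneralPosition : Subset n → Set
  MaximalGeneralPosition S =
    GeneralPosition S × (∀ T → GeneralPosition T → S ⊆ T → T ⊆ S)

  TerminalSet : Subset n → Set
  TerminalSet S =
    MaximalGeneralPosition S ×
    (∀ u → u ∉ S →
      Σ (Fin n) λ v → Σ (Walk u v) λ p → IsShortest p ×
        Σ (Fin n) λ x → Σ (Fin n) λ y →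
          x ∈ S × y ∈ S × x ≢ y × On x p × On y p)

  CycSucc : ∀ {k} → Fin k → Fin k → Set
  CycSucc {k} i j = (toℕ j ≡ suc (toℕ i)) ⊎ (toℕ i ≡ k ∸ 1 × toℕ j ≡ 0)

  IsInducedCycle : (k : ℕ) → (Fin k → Fin n) → Set
  IsInducedCycle k c =
    3 ≤ k × Injective _≡_ _≡_ c ×
    (∀ i j → (Adj (c i) (c j) → CycSucc i j ⊎ CycSucc j i) ×
             (CycSucc i j ⊎ CycSucc j i → Adj (c i) (c j)))

  Chordal : Set
  Chordal = ∀ k (c : Fin k → Fin n) → IsInducedCycle k c → k ≡ 3

-- In a chordal graph every connected component has a simplicial vertex; fix one, x,
-- per component (the least one).  The union S of the closed neighbourhoods N[x] is a
-- terminal set.  Each N[x] is a clique and a geodesic, being an induced path, meets a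
-- clique in at most two vertices; vertices of S on a common geodesic lie in one
-- component, hence in one N[x], so S is in general position.  For u ∉ S, a geodesic
-- from u to the x of its component ends with two vertices of S, its penultimate vertex
-- and x; this already forces maximality.
--
-- Simplicial vertices exist by Dirac's separator argument.  If W is not a clique, take
-- non-adjacent x, y in W, the component Comp of y in W ∖ N[x], and the vertices of W
-- outside Comp adjacent to it.  The latter form a clique: two non-adjacent ones are
-- common neighbours of x joined by a shortest detour through Comp, and x closes that
-- detour into an induced cycle of length at least four.

module Submission where

open import Defs
open import Data.Empty using (⊥; ⊥-elim)
open import Data.Fin using (Fin; zero; suc; toℕ; fromℕ<; inject) renaming (_<_ to _<ᶠ_)
open import Data.Fin.Properties
  using (_≟_; any?; all?; pigeonhole; toℕ≤pred[n]; toℕ-injective; toℕ-inject; toℕ-fromℕ<; ¬∀⟶∃¬-smallest)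
  renaming (<-cmp to <ᶠ-cmp; _<?_ to _<ᶠ?_)
open import Data.Fin.Subset using (Subset; _∈_; _∉_; _⊆_; _⊂_)
open import Data.Fin.Subset.Induction using (⊂-wellFounded)
open import Data.Fin.Subset.Properties using (_∈?_)
open import Data.Nat using (ℕ; zero; suc; _+_; _≤_; _<_; z≤n; s≤s)
open import Data.Nat.Induction using (<-wellFounded)
open import Data.Nat.Properties
  using ( ≤-refl; ≤-antisym; <-cmp; _<?_; ≮⇒≥; suc-injective
        ; +-assoc; +-comm; +-identityʳ; +-monoˡ-≤; +-monoˡ-<; +-cancelʳ-≤; module ≤-Reasoning)
open import Data.Product using (Σ; ∃; _×_; _,_; proj₁; proj₂)
open import Data.Sum using (_⊎_; inj₁; inj₂; [_,_])
open import Data.Vec using (tabulate)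
open import Data.Vec.Properties using (lookup∘tabulate; []=⇒lookup; lookup⇒[]=)
open import Function using (_∘_)
open import Function.Definitions using (Injective)
open import Induction.WellFounded using (Acc; acc)
open import Level using (0ℓ)
open import Relation.Binary.Definitions using (tri<; tri≈; tri>)
open import Relation.Binary.PropositionalEquality using (_≡_; _≢_; refl; sym; trans; cong; subst; subst₂)
open import Relation.Nullary using (¬_; Dec; yes; no; does)
open import Relation.Nullary.Decidable using (map′; _×-dec_; _⊎-dec_; _→-dec_; ¬?; dec-true; decidable-stable)
open import Relation.Unary using (Pred; Decidable; _∩_; _∪_; ∁; ∅; ｛_｝)
open import Relation.Unary.Properties using (_∩?_; _∪?_; ∁?; ∅?)

Consecutive : ℕ → ℕ → Set
Consecutive i j = j ≡ suc i ⊎ i ≡ suc j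

no-consecutive-triple : ∀ {i j k} → Consecutive i j → Consecutive j k → ¬ Consecutive i k
no-consecutive-triple (inj₁ refl) (inj₁ refl) = λ { (inj₁ ()) ; (inj₂ ()) }
no-consecutive-triple (inj₁ refl) (inj₂ refl) = λ { (inj₁ ()) ; (inj₂ ()) }
no-consecutive-triple (inj₂ refl) (inj₁ refl) = λ { (inj₁ ()) ; (inj₂ ()) }
no-consecutive-triple (inj₂ refl) (inj₂ refl) = λ { (inj₁ ()) ; (inj₂ ()) }

inject-fromℕ< : ∀ {n} {x y : Fin n} (y<x : y <ᶠ x) → inject (fromℕ< y<x) ≡ y
inject-fromℕ< y<x = toℕ-injective (trans (toℕ-inject (fromℕ< y<x)) (toℕ-fromℕ< y<x))

module _ {n : ℕ} {P : Pred (Fin n) 0ℓ} (P? : Decidable P) where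

  toSubset : Subset n
  toSubset = tabulate (does ∘ P?)

  ∈-toSubset⁺ : ∀ {x} → P x → x ∈ toSubset
  ∈-toSubset⁺ {x} px = lookup⇒[]= x toSubset (trans (lookup∘tabulate (does ∘ P?) x) (dec-true (P? x) px))

  ∈-toSubset⁻ : ∀ {x} → x ∈ toSubset → P x
  ∈-toSubset⁻ {x} x∈ with P? x | trans (sym (lookup∘tabulate (does ∘ P?) x)) ([]=⇒lookup x∈)
  ... | yes px | _ = px
  ... | no _   | ()

toSubset-⊂ : ∀ {n} {P Q : Pred (Fin n) 0ℓ} (P? : Decidable P) (Q? : Decidable Q) →
             (∀ {x} → P x → Q x) → ∀ {z} → Q z → ¬ P z → toSubset P? ⊂ toSubset Q?
toSubset-⊂ P? Q? P⊆Q {z} qz ¬pz =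
  (λ x∈ → ∈-toSubset⁺ Q? (P⊆Q (∈-toSubset⁻ P? x∈))) , z , ∈-toSubset⁺ Q? qz , ¬pz ∘ ∈-toSubset⁻ P?

module _ {n : ℕ} {G : Graph n} where
  open Graph G using (Adj; irrefl) renaming (sym to Adj-sym)

  infixr 5 _++_
  _++_ : ∀ {u v w} → Walk G u v → Walk G v w → Walk G u w
  []ʷ      ++ q = q
  (e ∷ʷ p) ++ q = e ∷ʷ (p ++ q)

  len-++ : ∀ {u v w} (p : Walk G u v) (q : Walk G v w) → len G (p ++ q) ≡ len G p + len G q
  len-++ []ʷ      q = refl
  len-++ (_ ∷ʷ p) q = cong suc (len-++ p q)

  reverse : ∀ {u v} → Walk G u v → Walk G v u
  reverse []ʷ      = []ʷ
  reverse (e ∷ʷ p) = reverse p ++ (Adj-sym e ∷ʷ []ʷ)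

  ≡⇒walk : ∀ {u v} → u ≡ v → Walk G u v
  ≡⇒walk refl = []ʷ

  len-≡⇒walk : ∀ {u v} (u≡v : u ≡ v) → len G (≡⇒walk u≡v) ≡ 0
  len-≡⇒walk refl = refl

  0<len : ∀ {u v} (p : Walk G u v) → u ≢ v → 0 < len G p
  0<len []ʷ      u≢u = ⊥-elim (u≢u refl)
  0<len (_ ∷ʷ _) _   = s≤s z≤n

  On-end : ∀ {u v} (p : Walk G u v) → On G v p
  On-end []ʷ      = here
  On-end (_ ∷ʷ p) = there (On-end p)

  prefix : ∀ {x u v} {p : Walk G u v} → On G x p → Walk G u x
  prefix here                = []ʷ
  prefix (there {e = e} x∈p) = e ∷ʷ prefix x∈p

  penultimate : ∀ {u v} (p : Walk G u v) → u ≢ v → ∃ λ y → On G y p × Adj y v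
  penultimate []ʷ      u≢u = ⊥-elim (u≢u refl)
  penultimate (e ∷ʷ p) _   = last-edge e p
    where
    last-edge : ∀ {u w v} (e : Adj u w) (p : Walk G w v) → ∃ λ y → On G y (e ∷ʷ p) × Adj y v
    last-edge e []ʷ      = _ , here , e
    last-edge _ (f ∷ʷ p) with y , y∈p , yv ← last-edge f p = y , there y∈p , yv

  vertex : ∀ {u v} → Walk G u v → ℕ → Fin n
  vertex {u} []ʷ      _       = u
  vertex {u} (_ ∷ʷ _) zero    = u
  vertex     (_ ∷ʷ p) (suc i) = vertex p i

  vertex-zero : ∀ {u v} (p : Walk G u v) → vertex p 0 ≡ u
  vertex-zero []ʷ      = refl
  vertex-zero (_ ∷ʷ _) = refl

  vertex-len : ∀ {u v} (p : Walk G u v) → vertex p (len G p) ≡ v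
  vertex-len []ʷ      = refl
  vertex-len (_ ∷ʷ p) = vertex-len p

  vertex-step : ∀ {u v} (p : Walk G u v) {i} → i < len G p → Adj (vertex p i) (vertex p (suc i))
  vertex-step (e ∷ʷ p) {zero}  _          = subst (Adj _) (sym (vertex-zero p)) e
  vertex-step (_ ∷ʷ p) {suc i} (s≤s i<p) = vertex-step p i<p

  On⇒vertex : ∀ {x u v} {p : Walk G u v} → On G x p → ∃ λ i → i ≤ len G p × vertex p i ≡ x
  On⇒vertex {p = p} here = 0 , z≤n , vertex-zero p
  On⇒vertex (there x∈p) with i , i≤p , refl ← On⇒vertex x∈p = suc i , s≤s i≤p , refl

  take : ∀ {u v} i (p : Walk G u v) → Walk G u (vertex p i)
  take _       []ʷ      = []ʷ
  take zero    (_ ∷ʷ _) = []ʷ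
  take (suc i) (e ∷ʷ p) = e ∷ʷ take i p

  len-take : ∀ {u v} i (p : Walk G u v) → len G (take i p) ≤ i
  len-take _       []ʷ      = z≤n
  len-take zero    (_ ∷ʷ _) = z≤n
  len-take (suc i) (_ ∷ʷ p) = s≤s (len-take i p)

  drop : ∀ {u v} i (p : Walk G u v) → Walk G (vertex p i) v
  drop _       []ʷ      = []ʷ
  drop zero    (e ∷ʷ p) = e ∷ʷ p
  drop (suc i) (_ ∷ʷ p) = drop i p

  len-drop : ∀ {u v} {i} (p : Walk G u v) → i ≤ len G p → i + len G (drop i p) ≡ len G p
  len-drop             []ʷ      z≤n        = refl
  len-drop {i = zero}  (_ ∷ʷ _) _          = refl
  len-drop {i = suc i} (_ ∷ʷ p) (s≤s i≤p) = cong suc (len-drop p i≤p)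

  splice : ∀ {u v} (p : Walk G u v) i j → Walk G (vertex p i) (vertex p j) → Walk G u v
  splice p i j q = take i p ++ q ++ drop j p

  len-splice : ∀ {u v} (p : Walk G u v) i j q →
               len G (splice p i j q) ≤ i + len G q + len G (drop j p)
  len-splice p i j q = begin
    len G (take i p ++ q ++ drop j p)                ≡⟨ len-++ (take i p) _ ⟩
    len G (take i p) + len G (q ++ drop j p)         ≡⟨ cong (len G (take i p) +_) (len-++ q _) ⟩
    len G (take i p) + (len G q + len G (drop j p))  ≤⟨ +-monoˡ-≤ _ (len-take i p) ⟩
    i + (len G q + len G (drop j p))                 ≡⟨ sym (+-assoc i _ _) ⟩
    i + len G q + len G (drop j p)                   ∎
    where open ≤-Reasoning

  skip-cycle : ∀ {u v} (p : Walk G u v) {i j} → i < j → j ≤ len G p → vertex p i ≡ vertex p j →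
               ∃ λ (q : Walk G u v) → len G q < len G p
  skip-cycle p {i} {j} i<j j≤p same = splice p i j (≡⇒walk same) , (begin-strict
    len G (splice p i j (≡⇒walk same))          ≤⟨ len-splice p i j (≡⇒walk same) ⟩
    i + len G (≡⇒walk same) + len G (drop j p)  ≡⟨ cong (λ l → i + l + len G (drop j p)) (len-≡⇒walk same) ⟩
    i + 0 + len G (drop j p)                    <⟨ +-monoˡ-< _ (subst (_< j) (sym (+-identityʳ i)) i<j) ⟩
    j + len G (drop j p)                        ≡⟨ len-drop p j≤p ⟩
    len G p                                     ∎)
    where open ≤-Reasoning

  shortest-segment : ∀ {u v} {p : Walk G u v} → IsShortest G p → ∀ {i j} → j ≤ len G p →
                     (q : Walk G (vertex p i) (vertex p j)) → j ≤ i + len G q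
  shortest-segment {p = p} shortest {i} {j} j≤p q = +-cancelʳ-≤ _ j (i + len G q) (begin
    j + len G (drop j p)            ≡⟨ len-drop p j≤p ⟩
    len G p                         ≤⟨ shortest (splice p i j q) ⟩
    len G (splice p i j q)          ≤⟨ len-splice p i j q ⟩
    i + len G q + len G (drop j p)  ∎)
    where open ≤-Reasoning

  shortest-injective : ∀ {u v} {p : Walk G u v} → IsShortest G p → ∀ {i j} → i ≤ len G p → j ≤ len G p →
                       vertex p i ≡ vertex p j → i ≡ j
  shortest-injective {p = p} shortest i≤p j≤p same = ≤-antisym (no-return i≤p (sym same)) (no-return j≤p same)
    where
    no-return : ∀ {i j} → j ≤ len G p → vertex p i ≡ vertex p j → j ≤ i
    no-return {i} {j} j≤p same = subst (j ≤_) (trans (cong (i +_) (len-≡⇒walk same)) (+-identityʳ i))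
                                       (shortest-segment shortest j≤p (≡⇒walk same))

  shortest-adjacent≤ : ∀ {u v} {p : Walk G u v} → IsShortest G p → ∀ {i j} → j ≤ len G p →
                       Adj (vertex p i) (vertex p j) → j ≤ suc i
  shortest-adjacent≤ shortest {i} {j} j≤p e =
    subst (j ≤_) (+-comm i 1) (shortest-segment shortest j≤p (e ∷ʷ []ʷ))

  shortest-adjacent : ∀ {u v} {p : Walk G u v} → IsShortest G p → ∀ {i j} → i ≤ len G p → j ≤ len G p →
                      Adj (vertex p i) (vertex p j) → Consecutive i j
  shortest-adjacent shortest {i} {j} i≤p j≤p e with <-cmp i j
  ... | tri< i<j _ _  = inj₁ (≤-antisym (shortest-adjacent≤ shortest j≤p e) i<j)
  ... | tri≈ _ refl _ = ⊥-elim (irrefl e)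
  ... | tri> _ _ j<i  = inj₂ (≤-antisym (shortest-adjacent≤ shortest i≤p (Adj-sym e)) j<i)

  shortest-no-triangle : ∀ {u v x y z} {p : Walk G u v} → IsShortest G p →
                         On G x p → On G y p → On G z p → Adj x y → Adj y z → Adj x z → ⊥
  shortest-no-triangle shortest x∈p y∈p z∈p xy yz xz
    with i , i≤p , refl ← On⇒vertex x∈p
       | j , j≤p , refl ← On⇒vertex y∈p
       | k , k≤p , refl ← On⇒vertex z∈p
    = no-consecutive-triple (shortest-adjacent shortest i≤p j≤p xy)
                            (shortest-adjacent shortest j≤p k≤p yz)
                            (shortest-adjacent shortest i≤p k≤p xz)

module _ {n : ℕ} (G : Graph n) where
  open Graph G using (Adj; adj?)

  shorter? : ∀ k u v → Dec (∃ λ (p : Walk G u v) → len G p < k)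
  shorter? zero    u v = no λ ()
  shorter? (suc k) u v = map′ extend shrink ((u ≟ v) ⊎-dec any? λ w → adj? u w ×-dec shorter? k w v)
    where
    extend : u ≡ v ⊎ (∃ λ w → Adj u w × ∃ λ (p : Walk G w v) → len G p < k) →
             ∃ λ (p : Walk G u v) → len G p < suc k
    extend (inj₁ refl)              = []ʷ , s≤s z≤n
    extend (inj₂ (_ , e , p , p<k)) = e ∷ʷ p , s≤s p<k
    shrink : (∃ λ (p : Walk G u v) → len G p < suc k) →
             u ≡ v ⊎ (∃ λ w → Adj u w × ∃ λ (p : Walk G w v) → len G p < k)
    shrink ([]ʷ , _)          = inj₁ refl
    shrink (e ∷ʷ p , s≤s p<k) = inj₂ (_ , e , p , p<k)

  cut-repetition : ∀ {u v} (p : Walk G u v) → n ≤ len G p → ∃ λ (q : Walk G u v) → len G q < len G p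
  cut-repetition p n≤p with i , j , i<j , same ← pigeonhole (s≤s n≤p) (λ i → vertex p (toℕ i)) =
    skip-cycle p i<j (toℕ≤pred[n] j) same

  shorten : ∀ {u v} (p : Walk G u v) → ∃ λ (q : Walk G u v) → len G q < n
  shorten p = go p (<-wellFounded (len G p))
    where
    go : ∀ {u v} (p : Walk G u v) → Acc _<_ (len G p) → ∃ λ (q : Walk G u v) → len G q < n
    go p (acc smaller) with len G p <? n
    ... | yes p<n = p , p<n
    ... | no p≮n with q , q<p ← cut-repetition p (≮⇒≥ p≮n) = go q (smaller q<p)

  connected? : ∀ u v → Dec (Walk G u v)
  connected? u v = map′ proj₁ shorten (shorter? n u v)

  shortest-exists : ∀ {u v} → Walk G u v → Σ (Walk G u v) (IsShortest G)
  shortest-exists p = go p (<-wellFounded (len G p))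
    where
    go : ∀ {u v} (p : Walk G u v) → Acc _<_ (len G p) → Σ (Walk G u v) (IsShortest G)
    go {u} {v} p (acc smaller) with shorter? (len G p) u v
    ... | yes (q , q<p) = go q (smaller q<p)
    ... | no  ∄q<p      = p , λ q → ≮⇒≥ λ q<p → ∄q<p (q , q<p)

induced : ∀ {n} (G : Graph n) {P : Pred (Fin n) 0ℓ} → Decidable P → Graph n
induced G {P} P? = record
  { Adj    = λ u v → P u × P v × Adj u v
  ; adj?   = λ u v → P? u ×-dec P? v ×-dec adj? u v
  ; sym    = λ (pu , pv , e) → pv , pu , Adj-sym e
  ; irrefl = λ (_ , _ , e) → irrefl e
  }
  where open Graph G renaming (sym to Adj-sym)

map-walk : ∀ {n} {G H : Graph n} → (∀ {a b} → Graph.Adj G a b → Graph.Adj H a b) →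
           ∀ {u v} → Walk G u v → Walk H u v
map-walk f []ʷ      = []ʷ
map-walk f (e ∷ʷ p) = f e ∷ʷ map-walk f p

module _ {n : ℕ} {G : Graph n} {P : Pred (Fin n) 0ℓ} (P? : Decidable P) where

  vertex-inside : ∀ {u v} → P u → (p : Walk (induced G P?) u v) → ∀ i → P (vertex p i)
  vertex-inside pu []ʷ                 _       = pu
  vertex-inside pu (_ ∷ʷ _)            zero    = pu
  vertex-inside _  ((_ , pw , _) ∷ʷ p) (suc i) = vertex-inside pw p i

  end-inside : ∀ {u v} → P u → Walk (induced G P?) u v → P v
  end-inside pu p = subst P (vertex-len p) (vertex-inside pu p (len _ p))

module Cliques {n : ℕ} (G : Graph n) where
  open Graph G renaming (sym to Adj-sym)

  N[_] : Fin n → Pred (Fin n) 0ℓ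
  N[ x ] v = x ≡ v ⊎ Adj x v

  N[_]? : ∀ x → Decidable N[ x ]
  N[ x ]? v = (x ≟ v) ⊎-dec adj? x v

  N[]⇒walk : ∀ {x v} → N[ x ] v → Walk G x v
  N[]⇒walk (inj₁ refl) = []ʷ
  N[]⇒walk (inj₂ e)    = e ∷ʷ []ʷ

  IsClique : Pred (Fin n) 0ℓ → Set
  IsClique K = ∀ {a b} → K a → K b → a ≢ b → Adj a b

  SimplicialIn : Pred (Fin n) 0ℓ → Fin n → Set
  SimplicialIn W v = IsClique (W ∩ Adj v)

  Simplicial : Fin n → Set
  Simplicial v = IsClique (Adj v)

  clique-or-nonadjacent : ∀ {K} → Decidable K → IsClique K ⊎ ∃ λ a → ∃ λ b → K a × K b × a ≢ b × ¬ Adj a b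
  clique-or-nonadjacent K? with any? (λ a → any? λ b → K? a ×-dec K? b ×-dec ¬? (a ≟ b) ×-dec ¬? (adj? a b))
  ... | yes pair = inj₂ pair
  ... | no ∄pair = inj₁ λ {a} {b} Ka Kb a≢b →
    decidable-stable (adj? a b) λ ¬ab → ∄pair (a , b , Ka , Kb , a≢b , ¬ab)

  isClique? : ∀ {K} → Decidable K → Dec (IsClique K)
  isClique? K? with clique-or-nonadjacent K?
  ... | inj₁ clique                        = yes clique
  ... | inj₂ (_ , _ , Ka , Kb , a≢b , ¬ab) = no λ clique → ¬ab (clique Ka Kb a≢b)

  simplicial? : Decidable Simplicial
  simplicial? v = isClique? (adj? v)

  simplicialIn-mono : ∀ {W W' v} → (∀ {a} → W a → Adj v a → W' a) → SimplicialIn W' v → SimplicialIn W v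
  simplicialIn-mono W⊆W' simplicial (Wa , va) (Wb , vb) =
    simplicial (W⊆W' Wa va , va) (W⊆W' Wb vb , vb)

  simplicial⇒N[]-clique : ∀ {x} → Simplicial x → IsClique N[ x ]
  simplicial⇒N[]-clique _          (inj₁ refl) (inj₁ refl) a≢a = ⊥-elim (a≢a refl)
  simplicial⇒N[]-clique _          (inj₁ refl) (inj₂ xb)   _   = xb
  simplicial⇒N[]-clique _          (inj₂ xa)   (inj₁ refl) _   = Adj-sym xa
  simplicial⇒N[]-clique simplicial (inj₂ xa)   (inj₂ xb)   a≢b = simplicial xa xb a≢b

module _ {n : ℕ} {G : Graph n} where
  open Graph G renaming (sym to Adj-sym)
  open Cliques G

  module DetourCycle {C : Pred (Fin n) 0ℓ} (C? : Decidable C) {x a b : Fin n}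
                     (C∩N[x]≡∅ : ∀ {c} → C c → ¬ N[ x ] c) (xa : Adj x a) (xb : Adj x b) (a≢b : a ≢ b)
                     (p : Walk (induced G (C? ∪? (a ≟_) ∪? (b ≟_))) a b)
                     (shortest : IsShortest _ p) where

    L : ℕ
    L = len _ p

    C⁺ : Pred (Fin n) 0ℓ
    C⁺ = C ∪ ｛ a ｝ ∪ ｛ b ｝

    inside : ∀ i → C⁺ (vertex p i)
    inside = vertex-inside (C? ∪? (a ≟_) ∪? (b ≟_)) (inj₂ (inj₁ refl)) p

    x-outside : ¬ C⁺ x
    x-outside (inj₁ Cx)         = C∩N[x]≡∅ Cx (inj₁ refl)
    x-outside (inj₂ (inj₁ a≡x)) = irrefl (subst (Adj x) a≡x xa)
    x-outside (inj₂ (inj₂ b≡x)) = irrefl (subst (Adj x) b≡x xb)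

    x-neighbour : ∀ {i} → i ≤ L → Adj x (vertex p i) → i ≡ 0 ⊎ i ≡ L
    x-neighbour {i} i≤L xi with inside i
    ... | inj₁ Ci         = ⊥-elim (C∩N[x]≡∅ Ci (inj₂ xi))
    ... | inj₂ (inj₁ a≡i) = inj₁ (sym (shortest-injective shortest z≤n i≤L (trans (vertex-zero p) a≡i)))
    ... | inj₂ (inj₂ b≡i) =
      inj₂ (shortest-injective shortest i≤L ≤-refl (trans (sym b≡i) (sym (vertex-len p))))

    x-adjacent-ends : ∀ {i} → i ≡ 0 ⊎ i ≡ L → Adj x (vertex p i)
    x-adjacent-ends (inj₁ refl) = subst (Adj x) (sym (vertex-zero p)) xa
    x-adjacent-ends (inj₂ refl) = subst (Adj x) (sym (vertex-len p)) xb

    cycle : Fin (2 + L) → Fin n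
    cycle zero    = x
    cycle (suc i) = vertex p (toℕ i)

    cycle-injective : Injective _≡_ _≡_ cycle
    cycle-injective {zero}  {zero}  _    = refl
    cycle-injective {zero}  {suc j} x≡j  = ⊥-elim (x-outside (subst C⁺ (sym x≡j) (inside _)))
    cycle-injective {suc i} {zero}  i≡x  = ⊥-elim (x-outside (subst C⁺ i≡x (inside _)))
    cycle-injective {suc i} {suc j} same =
      cong suc (toℕ-injective (shortest-injective shortest (toℕ≤pred[n] i) (toℕ≤pred[n] j) same))

    cycle-adjacent⇒ : ∀ i j → Adj (cycle i) (cycle j) → CycSucc G i j ⊎ CycSucc G j i
    cycle-adjacent⇒ zero    zero    xx = ⊥-elim (irrefl xx)
    cycle-adjacent⇒ zero    (suc j) xj with x-neighbour (toℕ≤pred[n] j) xj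
    ... | inj₁ j≡0 = inj₁ (inj₁ (cong suc j≡0))
    ... | inj₂ j≡L = inj₂ (inj₂ (cong suc j≡L , refl))
    cycle-adjacent⇒ (suc i) zero    ix with x-neighbour (toℕ≤pred[n] i) (Adj-sym ix)
    ... | inj₁ i≡0 = inj₂ (inj₁ (cong suc i≡0))
    ... | inj₂ i≡L = inj₁ (inj₂ (cong suc i≡L , refl))
    cycle-adjacent⇒ (suc i) (suc j) ij
      with shortest-adjacent shortest (toℕ≤pred[n] i) (toℕ≤pred[n] j) (inside _ , inside _ , ij)
    ... | inj₁ j≡1+i = inj₁ (inj₁ (cong suc j≡1+i))
    ... | inj₂ i≡1+j = inj₂ (inj₁ (cong suc i≡1+j))

    cycle-adjacent⇐ : ∀ i j → CycSucc G i j → Adj (cycle i) (cycle j)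
    cycle-adjacent⇐ zero    (suc j) (inj₁ j≡0)       = x-adjacent-ends (inj₁ (suc-injective j≡0))
    cycle-adjacent⇐ (suc i) zero    (inj₂ (i≡L , _)) = Adj-sym (x-adjacent-ends (inj₂ (suc-injective i≡L)))
    cycle-adjacent⇐ (suc i) (suc j) (inj₁ j≡1+i)     =
      subst (Adj _) (cong (vertex p) (sym (suc-injective j≡1+i))) (proj₂ (proj₂ (vertex-step p i<L)))
      where
      i<L : toℕ i < L
      i<L = subst (_≤ L) (suc-injective j≡1+i) (toℕ≤pred[n] j)
    cycle-adjacent⇐ zero    zero    (inj₁ ())
    cycle-adjacent⇐ zero    zero    (inj₂ (() , _))
    cycle-adjacent⇐ zero    (suc _) (inj₂ (() , _))
    cycle-adjacent⇐ (suc _) zero    (inj₁ ())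
    cycle-adjacent⇐ (suc _) (suc _) (inj₂ (_ , ()))

    cycle-induced : IsInducedCycle G (2 + L) cycle
    cycle-induced = s≤s (s≤s (0<len p a≢b)) , cycle-injective ,
                    λ i j → cycle-adjacent⇒ i j , [ cycle-adjacent⇐ i j , Adj-sym ∘ cycle-adjacent⇐ j i ]

    triangle⇒ends-adjacent : L ≡ 1 → Adj a b
    triangle⇒ends-adjacent L≡1 =
      subst₂ Adj (vertex-zero p) (trans (cong (vertex p) (sym L≡1)) (vertex-len p))
             (proj₂ (proj₂ (vertex-step p (0<len p a≢b))))

module _ {n : ℕ} (G : Graph n) where

  TwoOnGeodesicFrom : Subset n → Fin n → Set
  TwoOnGeodesicFrom S u =
    Σ (Fin n) λ v → Σ (Walk G u v) λ p → IsShortest G p ×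
      Σ (Fin n) λ x → Σ (Fin n) λ y → x ∈ S × y ∈ S × x ≢ y × On G x p × On G y p

  terminal-set : ∀ {S} → GeneralPosition G S → (∀ u → u ∉ S → TwoOnGeodesicFrom S u) → TerminalSet G S
  terminal-set {S} S-general witness = (S-general , maximal) , witness
    where
    apart : ∀ {u c} → u ∉ S → c ∈ S → u ≢ c
    apart u∉S c∈S refl = u∉S c∈S
    maximal : ∀ T → GeneralPosition G T → S ⊆ T → T ⊆ S
    maximal T T-general S⊆T {u} u∈T = decidable-stable (u ∈? S) λ u∉S →
      let (_ , p , shortest , a , b , a∈S , b∈S , a≢b , a∈p , b∈p) = witness u u∉S
      in T-general p shortest u a b u∈T (S⊆T a∈S) (S⊆T b∈S)
                   (apart u∉S a∈S) a≢b (apart u∉S b∈S) here a∈p b∈p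

module ChordalGraph {n : ℕ} (G : Graph n) (chordal : Chordal G) where
  open Graph G renaming (sym to Adj-sym)
  open Cliques G

  chordal-separation : ∀ {C : Pred (Fin n) 0ℓ} (C? : Decidable C) {x a b} →
                       (∀ {c} → C c → ¬ N[ x ] c) → Adj x a → Adj x b → a ≢ b → ¬ Adj a b →
                       ¬ Walk (induced G (C? ∪? (a ≟_) ∪? (b ≟_))) a b
  chordal-separation C? C∩N[x]≡∅ xa xb a≢b ¬ab detour
    with p , shortest ← shortest-exists _ detour
    = ¬ab (triangle⇒ends-adjacent (suc-injective (suc-injective (chordal _ cycle cycle-induced))))
    where open DetourCycle C? C∩N[x]≡∅ xa xb a≢b p shortest

  -- Avoiding a prescribed clique K is what lets the induction recurse into either side
  -- of a clique separator and come back with a vertex off the separator.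
  SimplicialOutsideCliques : Pred (Fin n) 0ℓ → Set₁
  SimplicialOutsideCliques W =
    ∀ {K} → Decidable K → IsClique K → ∀ {v₀} → W v₀ → ¬ K v₀ → ∃ λ v → W v × ¬ K v × SimplicialIn W v

  module Separator {W : Pred (Fin n) 0ℓ} (W? : Decidable W)
                   (IH : ∀ {W'} (W'? : Decidable W') → toSubset W'? ⊂ toSubset W? → SimplicialOutsideCliques W')
                   {x y} (Wx : W x) (Wy : W y) (x≢y : x ≢ y) (¬xy : ¬ Adj x y) where

    Far : Pred (Fin n) 0ℓ
    Far = W ∩ ∁ N[ x ]

    Far? : Decidable Far
    Far? = W? ∩? ∁? N[ x ]?

    Comp : Pred (Fin n) 0ℓ
    Comp = Walk (induced G Far?) y

    Comp? : Decidable Comp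
    Comp? = connected? (induced G Far?) y

    Boundary : Pred (Fin n) 0ℓ
    Boundary z = W z × ¬ Comp z × ∃ λ c → Comp c × Adj z c

    Boundary? : Decidable Boundary
    Boundary? z = W? z ×-dec ¬? (Comp? z) ×-dec any? λ c → Comp? c ×-dec adj? z c

    Comp⊆Far : ∀ {z} → Comp z → Far z
    Comp⊆Far = end-inside Far? (Wy , [ x≢y , ¬xy ])

    x∉Comp : ¬ Comp x
    x∉Comp Cx = proj₂ (Comp⊆Far Cx) (inj₁ refl)

    Boundary⊆N : ∀ {z} → Boundary z → Adj x z
    Boundary⊆N {z} (Wz , ¬Cz , c , Cc , zc) with N[ x ]? z
    ... | yes (inj₂ xz)   = xz
    ... | yes (inj₁ refl) = ⊥-elim (proj₂ (Comp⊆Far Cc) (inj₂ zc))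
    ... | no  ¬N[x]z      = ⊥-elim (¬Cz (Cc ++ ((Comp⊆Far Cc , (Wz , ¬N[x]z) , Adj-sym zc) ∷ʷ []ʷ)))

    x∉Boundary : ¬ Boundary x
    x∉Boundary Bx = irrefl (Boundary⊆N Bx)

    Boundary-clique : IsClique Boundary
    Boundary-clique {a} {b} Ba@(_ , _ , c , Cc , ac) Bb@(_ , _ , d , Cd , bd) a≢b with adj? a b
    ... | yes ab = ab
    ... | no ¬ab = ⊥-elim (chordal-separation Far? proj₂ (Boundary⊆N Ba) (Boundary⊆N Bb) a≢b ¬ab
                             ((inj₂ (inj₁ refl) , inj₁ (Comp⊆Far Cc) , ac) ∷ʷ
                               (map-walk (λ (fu , fv , e) → inj₁ fu , inj₁ fv , e) (reverse Cc ++ Cd) ++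
                                ((inj₁ (Comp⊆Far Cd) , inj₂ (inj₂ refl) , Adj-sym bd) ∷ʷ []ʷ))))

    Comp-neighbour : ∀ {v a} → Comp v → W a → Adj v a → (Comp ∪ Boundary) a
    Comp-neighbour {v} {a} Cv Wa va with Comp? a
    ... | yes Ca = inj₁ Ca
    ... | no ¬Ca = inj₂ (Wa , ¬Ca , v , Cv , Adj-sym va)

    simplicial-in-Comp : ∀ {K : Pred (Fin n) 0ℓ} → (∀ {k} → K k → ¬ Comp k) →
                         ∃ λ v → W v × ¬ K v × SimplicialIn W v
    simplicial-in-Comp {K} K∩Comp≡∅ =
      pick (IH (Comp? ∪? Boundary?) shrinks Boundary? Boundary-clique (inj₁ []ʷ) y∉Boundary)
      where
      shrinks : toSubset (Comp? ∪? Boundary?) ⊂ toSubset W?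
      shrinks = toSubset-⊂ (Comp? ∪? Boundary?) W? [ proj₁ ∘ Comp⊆Far , proj₁ ] Wx [ x∉Comp , x∉Boundary ]
      y∉Boundary : ¬ Boundary y
      y∉Boundary (_ , ¬Cy , _) = ¬Cy []ʷ
      pick : (∃ λ v → (Comp ∪ Boundary) v × ¬ Boundary v × SimplicialIn (Comp ∪ Boundary) v) →
             ∃ λ v → W v × ¬ K v × SimplicialIn W v
      pick (v , inj₂ Bv , ¬Bv , _)         = ⊥-elim (¬Bv Bv)
      pick (v , inj₁ Cv , _ , simplicial) =
        v , proj₁ (Comp⊆Far Cv) , (λ Kv → K∩Comp≡∅ Kv Cv) , simplicialIn-mono (Comp-neighbour Cv) simplicial

    simplicial-outside-Comp : ∀ {K : Pred (Fin n) 0ℓ} {k} → IsClique K → K k → Comp k →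
                              ∃ λ v → W v × ¬ K v × SimplicialIn W v
    simplicial-outside-Comp {K} {k} K-clique Kk Ck =
      pick (IH (W? ∩? ∁? Comp?) shrinks Boundary? Boundary-clique (Wx , x∉Comp) x∉Boundary)
      where
      shrinks : toSubset (W? ∩? ∁? Comp?) ⊂ toSubset W?
      shrinks = toSubset-⊂ (W? ∩? ∁? Comp?) W? proj₁ Wy (λ (_ , ¬Cy) → ¬Cy []ʷ)
      pick : (∃ λ v → (W ∩ ∁ Comp) v × ¬ Boundary v × SimplicialIn (W ∩ ∁ Comp) v) →
             ∃ λ v → W v × ¬ K v × SimplicialIn W v
      pick (v , (Wv , ¬Cv) , ¬Bv , simplicial) =
        v , Wv , ¬Kv , simplicialIn-mono (λ Wa va → Wa , λ Ca → ¬Bv (Wv , ¬Cv , _ , Ca , va)) simplicial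
        where
        ¬Kv : ¬ K v
        ¬Kv Kv with v ≟ k
        ... | yes refl = ¬Cv Ck
        ... | no  v≢k  = ¬Bv (Wv , ¬Cv , k , Ck , K-clique Kv Kk v≢k)

    simplicial-outside : ∀ {K : Pred (Fin n) 0ℓ} → Decidable K → IsClique K →
                         ∃ λ v → W v × ¬ K v × SimplicialIn W v
    simplicial-outside K? K-clique with any? (λ k → K? k ×-dec Comp? k)
    ... | yes (k , Kk , Ck) = simplicial-outside-Comp K-clique Kk Ck
    ... | no  ∄k            = simplicial-in-Comp λ Kk Ck → ∄k (_ , Kk , Ck)

  simplicial-outside-clique : ∀ {W} (W? : Decidable W) → SimplicialOutsideCliques W
  simplicial-outside-clique W? = go W? (⊂-wellFounded (toSubset W?))
    where
    go : ∀ {W} (W? : Decidable W) → Acc _⊂_ (toSubset W?) → SimplicialOutsideCliques W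
    go W? (acc smaller) K? K-clique Wv₀ ¬Kv₀ with clique-or-nonadjacent W?
    ... | inj₁ W-clique = _ , Wv₀ , ¬Kv₀ , λ (Wa , _) (Wb , _) → W-clique Wa Wb
    ... | inj₂ (x , y , Wx , Wy , x≢y , ¬xy) =
      Separator.simplicial-outside W? (λ W'? W'⊂W → go W'? (smaller W'⊂W)) Wx Wy x≢y ¬xy K? K-clique

  simplicial-in-component : ∀ u → ∃ λ v → Walk G u v × Simplicial v
  simplicial-in-component u
    with v , uv , _ , simplicial ← simplicial-outside-clique (connected? G u) ∅? (λ ()) []ʷ (λ ())
    = v , uv , λ va vb → simplicial (uv ++ (va ∷ʷ []ʷ) , va) (uv ++ (vb ∷ʷ []ʷ) , vb)

  Representative : Fin n → Set
  Representative x = Simplicial x × (∀ y → y <ᶠ x → Simplicial y → ¬ Walk G y x)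

  representative? : Decidable Representative
  representative? x =
    simplicial? x ×-dec all? λ y → (y <ᶠ? x) →-dec (simplicial? y →-dec ¬? (connected? G y x))

  representative-unique : ∀ {x x'} → Representative x → Representative x' → Walk G x x' → x ≡ x'
  representative-unique {x} {x'} (sx , x-least) (sx' , x'-least) xx' with <ᶠ-cmp x x'
  ... | tri< x<x' _ _ = ⊥-elim (x'-least x x<x' sx xx')
  ... | tri≈ _ x≡x' _ = x≡x'
  ... | tri> _ _ x'<x = ⊥-elim (x-least x' x'<x sx' (reverse xx'))

  SimplicialReachable : Fin n → Pred (Fin n) 0ℓ
  SimplicialReachable u x = Simplicial x × Walk G u x

  simplicialReachable? : ∀ u → Decidable (SimplicialReachable u)
  simplicialReachable? u x = simplicial? x ×-dec connected? G u x

  representative-exists : ∀ u → ∃ λ x → Representative x × Walk G u x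
  representative-exists u
    with v , uv , sv ← simplicial-in-component u
    with x , ¬¬ux , none-below ← ¬∀⟶∃¬-smallest n _ (∁? (simplicialReachable? u)) (λ none → none v (sv , uv))
    with sx , ux ← decidable-stable (simplicialReachable? u x) ¬¬ux
    = x , (sx , λ y y<x sy yx → none-below (fromℕ< y<x)
                  (subst (SimplicialReachable u) (sym (inject-fromℕ< y<x)) (sy , ux ++ reverse yx))) , ux

  NearRepresentative : Pred (Fin n) 0ℓ
  NearRepresentative v = ∃ λ x → Representative x × N[ x ] v

  nearRepresentative? : Decidable NearRepresentative
  nearRepresentative? v = any? λ x → representative? x ×-dec N[ x ]? v

  terminalSet : Subset n
  terminalSet = toSubset nearRepresentative?

  ∈-terminalSet⁺ : ∀ {v} → NearRepresentative v → v ∈ terminalSet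
  ∈-terminalSet⁺ = ∈-toSubset⁺ nearRepresentative?

  ∈-terminalSet⁻ : ∀ {v} → v ∈ terminalSet → NearRepresentative v
  ∈-terminalSet⁻ = ∈-toSubset⁻ nearRepresentative?

  representatives-on-walk : ∀ {u v a b x y} {p : Walk G u v} → Representative x → Representative y →
                            N[ x ] a → N[ y ] b → On G a p → On G b p → x ≡ y
  representatives-on-walk rx ry xa yb a∈p b∈p =
    representative-unique rx ry (N[]⇒walk xa ++ reverse (prefix a∈p) ++ prefix b∈p ++ reverse (N[]⇒walk yb))

  terminalSet-general : GeneralPosition G terminalSet
  terminalSet-general p shortest a b c a∈S b∈S c∈S a≢b b≢c a≢c a∈p b∈p c∈p
    with x , rx , xa ← ∈-terminalSet⁻ a∈S
       | y , ry , yb ← ∈-terminalSet⁻ b∈S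
       | z , rz , zc ← ∈-terminalSet⁻ c∈S
    with refl ← representatives-on-walk rx ry xa yb a∈p b∈p
       | refl ← representatives-on-walk rx rz xa zc a∈p c∈p
    = shortest-no-triangle shortest a∈p b∈p c∈p
        (N[x]-clique xa yb a≢b) (N[x]-clique yb zc b≢c) (N[x]-clique xa zc a≢c)
    where N[x]-clique = simplicial⇒N[]-clique (proj₁ rx)

  terminalSet-witness : ∀ u → u ∉ terminalSet → TwoOnGeodesicFrom G terminalSet u
  terminalSet-witness u u∉S
    with x , rx , ux ← representative-exists u
    with q , shortest ← shortest-exists G ux
    with y , y∈q , yx ← penultimate q (λ u≡x → u∉S (∈-terminalSet⁺ (x , rx , inj₁ (sym u≡x))))
    = x , q , shortest , y , x ,
      ∈-terminalSet⁺ (x , rx , inj₂ (Adj-sym yx)) , ∈-terminalSet⁺ (x , rx , inj₁ refl) ,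
      (λ y≡x → irrefl (subst (λ w → Adj w x) y≡x yx)) , y∈q , On-end q

corollary3p6 : ∀ (n : ℕ) (G : Graph n) → Chordal G →
    Σ (Subset n) λ S → TerminalSet G S
corollary3p6 n G chordal = terminalSet , terminal-set G terminalSet-general terminalSet-witness
  where open ChordalGraph G chordal
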